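{- Let $n$ be an odd positive integer. For every vertex $v\in\{0,1,\dots,n-1\}$ of $U_n$, $|D(v)|=(n^2-1)/4$.
   Context: $U_n$ is the tournament on vertex set $\{0,1,\dots,n-1\}$ where, for each pair $i<j$, the edge is directed $i\to j$ if $i+j$ is odd and $j\to i$ if $i+j$ is even. $\delta(u,v)$ is the number of directed paths of length $2$ from $u$ to $v$. A strong king in a tournament is a vertex $k$ from which every vertex is reachable by a path of length at most $2$ and such that for every $w$ with $w\to k$, $\delta(k,w)>\delta(w,k)$ (every vertex of $U_n$ is a strong king). For a vertex $v$ of $U_n$, $D(v)$ is the set of edges of $U_n$ such that reversing the direction of that single edge (and no other) yields a tournament in which $v$ is not a strong king. -}

module Defs where

open import Data.Bool using (Bool; true; false; not; _∧_; _∨_; if_then_else_)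
open import Data.Nat using (ℕ; _+_; _%_; _<ᵇ_; _≡ᵇ_; _<_)
open import Data.Fin using (Fin; toℕ; _≟_)
open import Data.List using (List; length; filter; allFin)
open import Data.Product using (_×_; ∃-syntax)
open import Data.Sum using (_⊎_)
open import Relation.Binary.PropositionalEquality using (_≡_)
open import Relation.Nullary using (does)
open import Relation.Nullary.Decidable using (⌊_⌋)
open import Data.Bool.Properties using (T?)

-- A (candidate) tournament on Fin n, given by its arc relation: T u v ≡ true iff u → v.
Tour : ℕ → Set
Tour n = Fin n → Fin n → Bool

Arc : ∀ {n} → Tour n → Fin n → Fin n → Set
Arc T u v = T u v ≡ true

U : (n : ℕ) → Tour n
U n i j =
  ((toℕ i <ᵇ toℕ j) ∧ (((toℕ i + toℕ j) % 2) ≡ᵇ 1))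
  ∨ ((toℕ j <ᵇ toℕ i) ∧ (((toℕ i + toℕ j) % 2) ≡ᵇ 0))

δ : ∀ {n} → Tour n → Fin n → Fin n → ℕ
δ {n} T u v = length (filter (λ w → T? (T u w ∧ T w v)) (allFin n))

StrongKing : ∀ {n} → Tour n → Fin n → Set
StrongKing {n} T k =
  (∀ (x : Fin n) → x ≡ k ⊎ Arc T k x ⊎ ∃[ w ] (Arc T k w × Arc T w x))
  × (∀ (w : Fin n) → Arc T w k → δ T w k < δ T k w)

reverseEdge : ∀ {n} → Tour n → Fin n → Fin n → Tour n
reverseEdge T a b x y =
  if (does (x ≟ a) ∧ does (y ≟ b)) ∨ (does (x ≟ b) ∧ does (y ≟ a))
  then not (T x y) else T x y

module Submission where

-- If w → v in a tournament, the out-neighbours of v split into those beating w and those common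
-- to v and w, and the out-neighbours of w into v itself, those beating v and the common ones; hence
-- δ(v,w) + score w = δ(w,v) + score v + 1, and v is a strong king exactly when no in-neighbour of
-- v has a larger score. In a regular tournament on 2m + 1 vertices, reversing an arc t → h gives t
-- score m − 1 and h score m + 1 and leaves every other score at m, so it dethrones v exactly when
-- v = t or h → v. That makes m arcs with tail v plus m · m arcs into the m in-neighbours of v,
-- and m² + m = (n² − 1)/4. Finally, U n is regular.

open import Defs

import Algebra.Properties.Semiring.Sum as Sum
open import Data.Bool using (Bool; true; false; not; _∧_; _∨_)
open import Data.Bool.Properties
  using (T?; T-≡; T-∧; not-¬; ¬-not; not-involutive; ∧-comm; ∧-identityʳ; ∧-zeroʳ; ∨-identityʳ; ∨-zeroʳ)
open import Data.Fin using (Fin; zero; suc; toℕ; _≟_; _<_; _<?_; punchIn)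
import Data.Fin.Properties as Fin
open import Data.Fin.Properties using (<-cmp; punchInᵢ≢i; toℕ-injective; toℕ<n; toℕ-inject₁; toℕ-fromℕ)
open import Data.List using (List; _∷_; _++_; length; filter; map; tabulate; allFin; cartesianProduct)
open import Data.List.Membership.Propositional using (_∈_)
open import Data.List.Membership.Propositional.Properties using (∈-filter⁻; ∈-filter⁺; ∈-cartesianProduct⁺; ∈-allFin)
open import Data.List.Properties using (length-++; filter-++; map-tabulate)
open import Data.List.Relation.Unary.Any using (here)
open import Data.List.Relation.Unary.Unique.Propositional using (Unique)
open import Data.List.Relation.Unary.Unique.Propositional.Properties using (filter⁺; cartesianProduct⁺; allFin⁺)
open import Data.Nat using (ℕ; zero; suc; _+_; _*_; _∸_; _/_; _%_; _<ᵇ_; _≡ᵇ_; _≤_; z≤n; s≤s)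
import Data.Nat as ℕ
open import Data.Nat.DivMod using (m≡m%n+[m/n]*n; m*n/n≡m)
import Data.Nat.Properties as ℕ
open import Data.Nat.Properties
  using ( +-*-semiring; +-comm; +-assoc; +-suc; +-identityʳ; *-comm; +-cancelˡ-≡; suc-injective
        ; ≤-refl; ≤-trans; ≤-reflexive; ≤-<-trans; <-trans; <⇒≤; <⇒≢; <⇒≱; ≤⇒≯; ≤∧≢⇒<
        ; n<1+n; n≤1+n; m≤n⇒m≤1+n; m<n⇒m<1+n; m<1+n⇒m<n∨m≡n
        ; +-monoˡ-≤; +-monoʳ-≤; +-cancelˡ-≤; +-cancelʳ-≤ )
open import Data.Nat.Solver using (module +-*-Solver)
open import Data.Product using (_×_; _,_; ∃-syntax; proj₂)
open import Data.Sum using (_⊎_; inj₁; inj₂; swap)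
open import Function using (_∘_; id)
open import Function.Bundles using (_⇔_; mk⇔; Equivalence)
open import Function.Construct.Composition using (_⇔-∘_)
open import Relation.Binary using (tri<; tri≈; tri>)
open import Relation.Binary.PropositionalEquality
open import Relation.Nullary using (¬_; contradiction; Dec; does; yes; no; _×-dec_; _⊎-dec_)
import Relation.Nullary.Decidable as Dec
open import Relation.Nullary.Decidable using (dec-true; dec-false)
open import Relation.Unary using (Pred; Decidable)

open Sum +-*-semiring
  using (sum; sum-syntax; sum-cong-≗; sum-remove; sum-init-last; sum-replicate-zero; ∑-comm; ∑-distrib-+; *-distribʳ-sum)

-- Counting over Fin n

𝟙 : Bool → ℕ
𝟙 true  = 1
𝟙 false = 0

𝟙-excluded : ∀ b → 𝟙 b + 𝟙 (not b) ≡ 1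
𝟙-excluded false = refl
𝟙-excluded true  = refl

count : ∀ {n} → (Fin n → Bool) → ℕ
count {n} p = ∑[ i < n ] 𝟙 (p i)

count-cong : ∀ {n} {p q : Fin n → Bool} → (∀ i → p i ≡ q i) → count p ≡ count q
count-cong p≗q = sum-cong-≗ (cong 𝟙 ∘ p≗q)

∑-agree-except : ∀ {n} (i : Fin n) {f g : Fin n → ℕ} → (∀ j → j ≢ i → f j ≡ g j) →
                 sum f + g i ≡ sum g + f i
∑-agree-except {suc n} i {f} {g} f≗g = begin
  sum f + g i                              ≡⟨ cong (_+ g i) (sum-remove f) ⟩
  f i + sum (f ∘ punchIn i) + g i          ≡⟨ cong (λ s → f i + s + g i) rest ⟩
  f i + sum (g ∘ punchIn i) + g i          ≡⟨ +-comm (f i + _) (g i) ⟩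
  g i + (f i + sum (g ∘ punchIn i))        ≡⟨ cong (g i +_) (+-comm (f i) _) ⟩
  g i + (sum (g ∘ punchIn i) + f i)        ≡⟨ +-assoc (g i) _ (f i) ⟨
  g i + sum (g ∘ punchIn i) + f i          ≡⟨ cong (_+ f i) (sum-remove g) ⟨
  sum g + f i                              ∎
  where
  open ≡-Reasoning
  rest : sum (f ∘ punchIn i) ≡ sum (g ∘ punchIn i)
  rest = sum-cong-≗ (λ j → f≗g (punchIn i j) (punchInᵢ≢i i j))

count-agree-except : ∀ {n} (i : Fin n) {p q : Fin n → Bool} → (∀ j → j ≢ i → p j ≡ q j) →
                     count p + 𝟙 (q i) ≡ count q + 𝟙 (p i)
count-agree-except i p≗q = ∑-agree-except i (λ j j≢i → cong 𝟙 (p≗q j j≢i))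

count-true : ∀ n → count {n} (λ _ → true) ≡ n
count-true zero    = refl
count-true (suc n) = cong suc (count-true n)

count-+ : ∀ {n} (p q : Fin n → Bool) → count p + count q ≡ ∑[ i < n ] (𝟙 (p i) + 𝟙 (q i))
count-+ p q = sym (∑-distrib-+ (𝟙 ∘ p) (𝟙 ∘ q))

count-split : ∀ {n} (p q : Fin n → Bool) →
              count p ≡ count (λ i → p i ∧ q i) + count (λ i → p i ∧ not (q i))
count-split p q = trans (sum-cong-≗ (λ i → split (p i) (q i))) (sym (count-+ (λ i → p i ∧ q i) _))
  where
  split : ∀ a b → 𝟙 a ≡ 𝟙 (a ∧ b) + 𝟙 (a ∧ not b)
  split false b     = refl
  split true  true  = refl
  split true  false = refl

count-complement : ∀ {n} (p : Fin n → Bool) → count p + count (not ∘ p) ≡ n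
count-complement {n} p = trans (count-+ p (not ∘ p)) (trans (sum-cong-≗ (𝟙-excluded ∘ p)) (count-true n))

count-at : ∀ {n} (i : Fin n) (p : Fin n → Bool) → count (λ j → p j ∧ does (j ≟ i)) ≡ 𝟙 (p i)
count-at {n} i p = begin
  count (λ j → p j ∧ does (j ≟ i))                   ≡⟨ +-identityʳ _ ⟨
  count (λ j → p j ∧ does (j ≟ i)) + 𝟙 false         ≡⟨ count-agree-except i off ⟩
  count {n} (λ _ → false) + 𝟙 (p i ∧ does (i ≟ i))   ≡⟨ cong₂ _+_ (sum-replicate-zero n) (cong (λ b → 𝟙 (p i ∧ b)) (dec-true (i ≟ i) refl)) ⟩
  𝟙 (p i ∧ true)                                     ≡⟨ cong 𝟙 (∧-identityʳ (p i)) ⟩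
  𝟙 (p i)                                            ∎
  where
  open ≡-Reasoning
  off : ∀ j → j ≢ i → p j ∧ does (j ≟ i) ≡ false
  off j j≢i rewrite dec-false (j ≟ i) j≢i = ∧-zeroʳ (p j)

length-filter-tabulate : ∀ {a p} {A : Set a} {P : Pred A p} (P? : Decidable P) {n} (f : Fin n → A) →
                         length (filter P? (tabulate f)) ≡ count (λ i → does (P? (f i)))
length-filter-tabulate P? {zero}  f = refl
length-filter-tabulate P? {suc n} f with does (P? (f zero))
... | true  = cong suc (length-filter-tabulate P? (f ∘ suc))
... | false = length-filter-tabulate P? (f ∘ suc)

length-filter-cartesianProduct :
  ∀ {a b p} {A : Set a} {B : Set b} {P : Pred (A × B) p} (P? : Decidable P) {m n}
  (f : Fin m → A) (g : Fin n → B) →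
  length (filter P? (cartesianProduct (tabulate f) (tabulate g))) ≡ ∑[ i < m ] count (λ j → does (P? (f i , g j)))
length-filter-cartesianProduct P? {zero}  f g = refl
length-filter-cartesianProduct {A = A} {B = B} P? {suc m} f g = begin
  length (filter P? (row ++ rows))             ≡⟨ cong length (filter-++ P? row rows) ⟩
  length (filter P? row ++ filter P? rows)     ≡⟨ length-++ (filter P? row) ⟩
  length (filter P? row) + length (filter P? rows)
    ≡⟨ cong₂ _+_ (trans (cong (length ∘ filter P?) (map-tabulate g (f zero ,_))) (length-filter-tabulate P? (λ j → f zero , g j)))
                 (length-filter-cartesianProduct P? (f ∘ suc) g) ⟩
  ∑[ i < suc m ] count (λ j → does (P? (f i , g j))) ∎
  where
  open ≡-Reasoning
  row rows : List (A × B)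
  row  = map (f zero ,_) (tabulate g)
  rows = cartesianProduct (tabulate (f ∘ suc)) (tabulate g)

count-unorderedPairs : ∀ {n} (d : Fin n → Fin n → Bool) → (∀ a b → d a b ≡ true → d b a ≡ false) →
                       ∑[ a < n ] count (λ b → does (a <? b) ∧ (d a b ∨ d b a)) ≡ ∑[ a < n ] count (d a)
count-unorderedPairs {n} d asym = begin
  ∑[ a < n ] count (λ b → lt a b ∧ (d a b ∨ d b a))
    ≡⟨ sum-cong-≗ (λ a → trans (sum-cong-≗ (λ b → split-∨ (lt a b) (asym a b))) (sym (count-+ (λ b → lt a b ∧ d a b) _))) ⟩
  ∑[ a < n ] (count (λ b → lt a b ∧ d a b) + count (λ b → lt a b ∧ d b a))
    ≡⟨ ∑-distrib-+ (λ a → count (λ b → lt a b ∧ d a b)) _ ⟩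
  ∑[ a < n ] count (λ b → lt a b ∧ d a b) + ∑[ a < n ] count (λ b → lt a b ∧ d b a)
    ≡⟨ cong (∑[ a < n ] count (λ b → lt a b ∧ d a b) +_) (∑-comm (λ a b → 𝟙 (lt a b ∧ d b a))) ⟩
  ∑[ a < n ] count (λ b → lt a b ∧ d a b) + ∑[ a < n ] count (λ b → lt b a ∧ d a b)
    ≡⟨ ∑-distrib-+ (λ a → count (λ b → lt a b ∧ d a b)) _ ⟨
  ∑[ a < n ] (count (λ b → lt a b ∧ d a b) + count (λ b → lt b a ∧ d a b))
    ≡⟨ sum-cong-≗ (λ a → trans (count-+ (λ b → lt a b ∧ d a b) _) (sum-cong-≗ (trichotomy a))) ⟩
  ∑[ a < n ] count (d a) ∎
  where
  open ≡-Reasoning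

  lt : Fin n → Fin n → Bool
  lt a b = does (a <? b)

  split-∨ : ∀ l {x y} → (x ≡ true → y ≡ false) → 𝟙 (l ∧ (x ∨ y)) ≡ 𝟙 (l ∧ x) + 𝟙 (l ∧ y)
  split-∨ false _ = refl
  split-∨ true {false} _ = refl
  split-∨ true {true} x⇒¬y rewrite x⇒¬y refl = refl

  irreflexive : ∀ a → d a a ≡ false
  irreflexive a with d a a in eq
  ... | false = refl
  ... | true  = trans (sym eq) (asym a a eq)

  trichotomy : ∀ a b → 𝟙 (lt a b ∧ d a b) + 𝟙 (lt b a ∧ d a b) ≡ 𝟙 (d a b)
  trichotomy a b with <-cmp a b
  ... | tri< a<b _ b≮a rewrite dec-true (a <? b) a<b | dec-false (b <? a) b≮a = +-identityʳ _
  ... | tri≈ _ refl _ rewrite irreflexive a | ∧-zeroʳ (lt a a) = refl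
  ... | tri> a≮b _ b<a rewrite dec-false (a <? b) a≮b | dec-true (b <? a) b<a = refl

-- Scores and strong kings

record IsTournament {n} (T : Tour n) : Set where
  field
    irreflexive : ∀ x → T x x ≡ false
    opposite    : ∀ {x y} → x ≢ y → T y x ≡ not (T x y)

  arc⇒≢ : ∀ {x y} → Arc T x y → x ≢ y
  arc⇒≢ {x} x→y refl with trans (sym x→y) (irreflexive x)
  ... | ()

  arc⇒converse≡false : ∀ {x y} → Arc T x y → T y x ≡ false
  arc⇒converse≡false x→y = trans (opposite (arc⇒≢ x→y)) (cong not x→y)

  asymmetric : ∀ {x y} → Arc T x y → ¬ Arc T y x
  asymmetric x→y y→x = not-¬ y→x (arc⇒converse≡false x→y)

  ¬arc⇒arc : ∀ {x y} → x ≢ y → ¬ Arc T x y → Arc T y x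
  ¬arc⇒arc x≢y x↛y = trans (opposite x≢y) (cong not (¬-not x↛y))

open IsTournament

arc? : ∀ {n} (T : Tour n) x y → Dec (Arc T x y)
arc? T x y = Dec.map T-≡ (T? (T x y))

score : ∀ {n} → Tour n → Fin n → ℕ
score T x = count (T x)

inScore : ∀ {n} → Tour n → Fin n → ℕ
inScore T x = count (λ y → T y x)

commonOut : ∀ {n} → Tour n → Fin n → Fin n → ℕ
commonOut T v w = count (λ x → T v x ∧ T w x)

δ≡count : ∀ {n} (T : Tour n) u v → δ T u v ≡ count (λ w → T u w ∧ T w v)
δ≡count {n} T u v = length-filter-tabulate (λ w → T? (T u w ∧ T w v)) id

module _ {n} {T : Tour n} (tournament : IsTournament T) where

  suc[score+inScore] : ∀ x → suc (score T x + inScore T x) ≡ n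
  suc[score+inScore] x = begin
    suc (score T x + inScore T x)                    ≡⟨ +-suc (score T x) _ ⟨
    score T x + suc (inScore T x)                    ≡⟨ cong (score T x +_) (+-comm 1 _) ⟩
    score T x + (inScore T x + 1)                    ≡⟨ cong (λ b → score T x + (inScore T x + 𝟙 (not b))) (irreflexive tournament x) ⟨
    score T x + (inScore T x + 𝟙 (not (T x x)))      ≡⟨ cong (score T x +_) (count-agree-except x converse) ⟩
    score T x + (count (not ∘ T x) + 𝟙 (T x x))      ≡⟨ cong (λ b → score T x + (count (not ∘ T x) + 𝟙 b)) (irreflexive tournament x) ⟩
    score T x + (count (not ∘ T x) + 0)              ≡⟨ cong (score T x +_) (+-identityʳ _) ⟩
    score T x + count (not ∘ T x)                    ≡⟨ count-complement (T x) ⟩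
    n                                                ∎
    where
    open ≡-Reasoning
    converse : ∀ y → y ≢ x → T y x ≡ not (T x y)
    converse y y≢x = opposite tournament (y≢x ∘ sym)

  score-loser : ∀ {v w} → Arc T w v → score T v ≡ δ T v w + commonOut T v w
  score-loser {v} {w} w→v = begin
    count (T v)                                                        ≡⟨ count-split (T v) (λ x → T x w) ⟩
    count (λ x → T v x ∧ T x w) + count (λ x → T v x ∧ not (T x w))   ≡⟨ cong₂ _+_ (δ≡count T v w) (count-cong w-loses) ⟨
    δ T v w + commonOut T v w                                          ∎
    where
    open ≡-Reasoning
    w-loses : ∀ x → T v x ∧ T w x ≡ T v x ∧ not (T x w)
    w-loses x with x ≟ w
    ... | yes refl rewrite arc⇒converse≡false tournament w→v = refl
    ... | no x≢w   = cong (T v x ∧_) (opposite tournament x≢w)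

  score-winner : ∀ {v w} → Arc T w v → score T w ≡ suc (δ T w v + commonOut T v w)
  score-winner {v} {w} w→v = begin
    count (T w)                                                        ≡⟨ count-split (T w) (λ x → T x v) ⟩
    count (λ x → T w x ∧ T x v) + count (λ x → T w x ∧ not (T x v))   ≡⟨ cong₂ _+_ (sym (δ≡count T w v)) others ⟩
    δ T w v + suc (commonOut T v w)                                    ≡⟨ +-suc (δ T w v) _ ⟩
    suc (δ T w v + commonOut T v w)                                    ∎
    where
    open ≡-Reasoning
    v-loses : ∀ x → x ≢ v → T w x ∧ not (T x v) ≡ T v x ∧ T w x
    v-loses x x≢v = trans (cong (T w x ∧_) (sym (opposite tournament x≢v))) (∧-comm (T w x) _)
    others : count (λ x → T w x ∧ not (T x v)) ≡ suc (commonOut T v w)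
    others = begin
      count (λ x → T w x ∧ not (T x v))
        ≡⟨ +-identityʳ _ ⟨
      count (λ x → T w x ∧ not (T x v)) + 0
        ≡⟨ cong (λ b → count (λ x → T w x ∧ not (T x v)) + 𝟙 (b ∧ T w v)) (irreflexive tournament v) ⟨
      count (λ x → T w x ∧ not (T x v)) + 𝟙 (T v v ∧ T w v)
        ≡⟨ count-agree-except v v-loses ⟩
      commonOut T v w + 𝟙 (T w v ∧ not (T v v))
        ≡⟨ cong₂ (λ b c → commonOut T v w + 𝟙 (b ∧ not c)) w→v (irreflexive tournament v) ⟩
      commonOut T v w + 1
        ≡⟨ +-comm _ 1 ⟩
      suc (commonOut T v w) ∎

  δ-balance : ∀ {v w} → Arc T w v → δ T v w + score T w ≡ suc (δ T w v + score T v)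
  δ-balance {v} {w} w→v rewrite score-winner w→v | score-loser w→v =
    solve 3 (λ a b c → a :+ (con 1 :+ (b :+ c)) := con 1 :+ (b :+ (a :+ c))) refl (δ T v w) (δ T w v) (commonOut T v w)
    where open +-*-Solver

ScoreDominant : ∀ {n} → Tour n → Fin n → Set
ScoreDominant {n} T v = ∀ (w : Fin n) → Arc T w v → score T w ≤ score T v

<⇔≤-of-balance : ∀ {a b c d} → a + c ≡ suc (b + d) → b ℕ.< a ⇔ c ≤ d
<⇔≤-of-balance {a} {b} {c} {d} balance = mk⇔
  (λ b<a → +-cancelˡ-≤ (suc b) c d (≤-trans (+-monoˡ-≤ c b<a) (≤-reflexive balance)))
  (λ c≤d → +-cancelʳ-≤ d (suc b) a (≤-trans (≤-reflexive (sym balance)) (+-monoʳ-≤ a c≤d)))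

∈-nonEmpty : ∀ {a} {A : Set a} {xs : List A} → 0 ℕ.< length xs → ∃[ x ] x ∈ xs
∈-nonEmpty {xs = x ∷ _} _ = x , here refl

path-of-δ>0 : ∀ {n} (T : Tour n) {u x} → 0 ℕ.< δ T u x → ∃[ w ] (Arc T u w × Arc T w x)
path-of-δ>0 {n} T {u} {x} δ>0 with ∈-nonEmpty δ>0
... | w , w∈ with Equivalence.to T-∧ (proj₂ (∈-filter⁻ (λ w → T? (T u w ∧ T w x)) {xs = allFin n} w∈))
...   | u→w , w→x = w , Equivalence.to T-≡ u→w , Equivalence.to T-≡ w→x

module _ {n} {T : Tour n} (tournament : IsTournament T) where

  strongKing⇔scoreDominant : ∀ v → StrongKing T v ⇔ ScoreDominant T v
  strongKing⇔scoreDominant v = mk⇔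
    (λ (_ , beats) w w→v → Equivalence.to (<⇔≤-of-balance (δ-balance tournament w→v)) (beats w w→v))
    (λ dominant → reach dominant , beats dominant)
    where
    beats : ScoreDominant T v → ∀ w → Arc T w v → δ T w v ℕ.< δ T v w
    beats dominant w w→v = Equivalence.from (<⇔≤-of-balance (δ-balance tournament w→v)) (dominant w w→v)

    reach : ScoreDominant T v → ∀ x → x ≡ v ⊎ Arc T v x ⊎ ∃[ w ] (Arc T v w × Arc T w x)
    reach dominant x with x ≟ v | arc? T v x
    ... | yes x≡v | _         = inj₁ x≡v
    ... | no _    | yes v→x   = inj₂ (inj₁ v→x)
    ... | no x≢v  | no v↛x    =
      inj₂ (inj₂ (path-of-δ>0 T (≤-<-trans z≤n (beats dominant x (¬arc⇒arc tournament (x≢v ∘ sym) v↛x)))))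

-- Reversing a single arc

OnEdge : ∀ {n} → Fin n → Fin n → Fin n → Fin n → Set
OnEdge a b x y = (x ≡ a × y ≡ b) ⊎ (x ≡ b × y ≡ a)

-- does (onEdge? a b x y) is literally the test made by reverseEdge T a b x y.
onEdge? : ∀ {n} (a b x y : Fin n) → Dec (OnEdge a b x y)
onEdge? a b x y = (x ≟ a ×-dec y ≟ b) ⊎-dec (x ≟ b ×-dec y ≟ a)

OnEdge-swap : ∀ {n} {a b x y : Fin n} → OnEdge a b x y → OnEdge a b y x
OnEdge-swap (inj₁ (x≡a , y≡b)) = inj₂ (y≡b , x≡a)
OnEdge-swap (inj₂ (x≡b , y≡a)) = inj₁ (y≡a , x≡b)

OnEdge-sameEdge : ∀ {n} {a b t h x y : Fin n} → OnEdge a b t h → OnEdge a b x y → OnEdge t h x y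
OnEdge-sameEdge (inj₁ (refl , refl)) on = on
OnEdge-sameEdge (inj₂ (refl , refl)) (inj₁ on) = inj₂ on
OnEdge-sameEdge (inj₂ (refl , refl)) (inj₂ on) = inj₁ on

module _ {n} (T : Tour n) {a b : Fin n} where

  reverseEdge-on : ∀ {x y} → OnEdge a b x y → reverseEdge T a b x y ≡ not (T x y)
  reverseEdge-on {x} {y} on rewrite dec-true (onEdge? a b x y) on = refl

  reverseEdge-off : ∀ {x y} → ¬ OnEdge a b x y → reverseEdge T a b x y ≡ T x y
  reverseEdge-off {x} {y} off rewrite dec-false (onEdge? a b x y) off = refl

  reverseEdge-isTournament : IsTournament T → a ≢ b → IsTournament (reverseEdge T a b)
  reverseEdge-isTournament tournament a≢b = record
    { irreflexive = λ x → trans (reverseEdge-off (off-diagonal x)) (irreflexive tournament x)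
    ; opposite    = flipped
    }
    where
    off-diagonal : ∀ x → ¬ OnEdge a b x x
    off-diagonal x (inj₁ (refl , x≡b)) = a≢b x≡b
    off-diagonal x (inj₂ (refl , x≡a)) = a≢b (sym x≡a)
    flipped : ∀ {x y} → x ≢ y → reverseEdge T a b y x ≡ not (reverseEdge T a b x y)
    flipped {x} {y} x≢y with onEdge? a b x y
    ... | yes on rewrite reverseEdge-on on | reverseEdge-on (OnEdge-swap on) = cong not (opposite tournament x≢y)
    ... | no off rewrite reverseEdge-off off | reverseEdge-off (off ∘ OnEdge-swap) = opposite tournament x≢y

record IsArcReversal {n} (T T' : Tour n) (t h : Fin n) : Set where
  field
    reversed  : Arc T' h t
    unchanged : ∀ {x y} → ¬ OnEdge t h x y → T' x y ≡ T x y

reverseEdge-isArcReversal : ∀ {n} {T : Tour n} → IsTournament T → ∀ {a b t h} →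
                            Arc T t h → OnEdge a b t h → IsArcReversal T (reverseEdge T a b) t h
reverseEdge-isArcReversal {T = T} tournament t→h th∈ab = record
  { reversed  = trans (reverseEdge-on T (OnEdge-swap th∈ab)) (cong not (arc⇒converse≡false tournament t→h))
  ; unchanged = λ off → reverseEdge-off T (off ∘ OnEdge-sameEdge th∈ab)
  }

module ArcReversal {n} {T T' : Tour n} (tournament : IsTournament T) (tournament' : IsTournament T')
                   {m} (regular : ∀ x → score T x ≡ m) {t h} (t→h : Arc T t h) (reversal : IsArcReversal T T' t h) where

  open IsArcReversal reversal

  private
    t≢h : t ≢ h
    t≢h = arc⇒≢ tournament t→h

    tail-row : ∀ {y} → y ≢ h → T' t y ≡ T t y
    tail-row y≢h = unchanged λ { (inj₁ (_ , y≡h)) → y≢h y≡h ; (inj₂ (t≡h , _)) → t≢h t≡h }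

    head-row : ∀ {y} → y ≢ t → T' h y ≡ T h y
    head-row y≢t = unchanged λ { (inj₁ (h≡t , _)) → t≢h (sym h≡t) ; (inj₂ (_ , y≡t)) → y≢t y≡t }

    other-row : ∀ {x y} → x ≢ t → x ≢ h → T' x y ≡ T x y
    other-row x≢t x≢h = unchanged λ { (inj₁ (x≡t , _)) → x≢t x≡t ; (inj₂ (x≡h , _)) → x≢h x≡h }

  score-tail : suc (score T' t) ≡ m
  score-tail = begin
    suc (score T' t)               ≡⟨ +-comm 1 _ ⟩
    score T' t + 1                 ≡⟨ cong (λ b → score T' t + 𝟙 b) t→h ⟨
    score T' t + 𝟙 (T t h)         ≡⟨ count-agree-except h (λ y → tail-row) ⟩
    score T t + 𝟙 (T' t h)         ≡⟨ cong₂ (λ s b → s + 𝟙 b) (regular t) (arc⇒converse≡false tournament' reversed) ⟩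
    m + 0                          ≡⟨ +-identityʳ m ⟩
    m                              ∎
    where open ≡-Reasoning

  score-head : score T' h ≡ suc m
  score-head = begin
    score T' h                     ≡⟨ +-identityʳ _ ⟨
    score T' h + 0                 ≡⟨ cong (λ b → score T' h + 𝟙 b) (arc⇒converse≡false tournament t→h) ⟨
    score T' h + 𝟙 (T h t)         ≡⟨ count-agree-except t (λ y → head-row) ⟩
    score T h + 𝟙 (T' h t)         ≡⟨ cong₂ (λ s b → s + 𝟙 b) (regular h) reversed ⟩
    m + 1                          ≡⟨ +-comm m 1 ⟩
    suc m                          ∎
    where open ≡-Reasoning

  score-other : ∀ {x} → x ≢ t → x ≢ h → score T' x ≡ m
  score-other {x} x≢t x≢h = trans (count-cong {p = T' x} (λ y → other-row x≢t x≢h)) (regular x)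

  score-tail< : score T' t ℕ.< m
  score-tail< = ≤-reflexive score-tail

  score≤suc : ∀ x → score T' x ≤ suc m
  score≤suc x with x ≟ t | x ≟ h
  ... | yes refl | _        = m≤n⇒m≤1+n (<⇒≤ score-tail<)
  ... | no _     | yes refl = ≤-reflexive score-head
  ... | no x≢t   | no x≢h   = m≤n⇒m≤1+n (≤-reflexive (score-other x≢t x≢h))

  ¬strongKing⇔ : ∀ v → (¬ StrongKing T' v) ⇔ (t ≡ v ⊎ Arc T h v)
  ¬strongKing⇔ v = mk⇔ destroyed killed
    where
    dominant⇒strongKing : ScoreDominant T' v → StrongKing T' v
    dominant⇒strongKing = Equivalence.from (strongKing⇔scoreDominant tournament' v)

    strongKing⇒dominant : StrongKing T' v → ScoreDominant T' v
    strongKing⇒dominant = Equivalence.to (strongKing⇔scoreDominant tournament' v)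

    killed : t ≡ v ⊎ Arc T h v → ¬ StrongKing T' v
    killed (inj₁ refl) king = <⇒≱ (<-trans score-tail< (subst (m ℕ.<_) (sym score-head) (n<1+n m)))
                                   (strongKing⇒dominant king h reversed)
    killed (inj₂ h→v)  king = <⇒≱ (subst₂ ℕ._<_ (sym (score-other v≢t v≢h)) (sym score-head) (n<1+n m))
                                   (strongKing⇒dominant king h (trans (head-row v≢t) h→v))
      where
      v≢t : v ≢ t
      v≢t refl = asymmetric tournament t→h h→v
      v≢h : v ≢ h
      v≢h = arc⇒≢ tournament h→v ∘ sym

    dominant : t ≢ v → ¬ Arc T h v → ScoreDominant T' v
    dominant t≢v h↛v w w→v with v ≟ h | w ≟ h | w ≟ t
    ... | yes refl | _        | _        = subst (score T' w ≤_) (sym score-head) (score≤suc w)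
    ... | no _     | yes refl | _        = contradiction (trans (sym (head-row (t≢v ∘ sym))) w→v) h↛v
    ... | no v≢h   | no _     | yes refl = subst (score T' t ≤_) (sym (score-other (t≢v ∘ sym) v≢h)) (<⇒≤ score-tail<)
    ... | no v≢h   | no w≢h   | no w≢t   = ≤-reflexive (trans (score-other w≢t w≢h) (sym (score-other (t≢v ∘ sym) v≢h)))

    destroyed : ¬ StrongKing T' v → t ≡ v ⊎ Arc T h v
    destroyed ¬king with t ≟ v | arc? T h v
    ... | yes t≡v | _       = inj₁ t≡v
    ... | no _    | yes h→v = inj₂ h→v
    ... | no t≢v  | no h↛v  = contradiction (dominant⇒strongKing (dominant t≢v h↛v)) ¬king

-- Regular tournaments

-- The arcs t → h whose reversal stops v being a strong king, as characterised by ArcReversal.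
Destroys : ∀ {n} → Tour n → Fin n → Fin n → Fin n → Set
Destroys T v t h = Arc T t h × (t ≡ v ⊎ Arc T h v)

destroys? : ∀ {n} (T : Tour n) v t h → Dec (Destroys T v t h)
destroys? T v t h = arc? T t h ×-dec ((t ≟ v) ⊎-dec arc? T h v)

module RegularTournament {n} {T : Tour n} (tournament : IsTournament T)
                         {m} (n≡2m+1 : n ≡ suc (m + m)) (regular : ∀ x → score T x ≡ m) (v : Fin n) where

  inScore-regular : ∀ x → inScore T x ≡ m
  inScore-regular x = +-cancelˡ-≡ m _ _ (suc-injective (begin
    suc (m + inScore T x)            ≡⟨ cong (λ s → suc (s + inScore T x)) (regular x) ⟨
    suc (score T x + inScore T x)    ≡⟨ suc[score+inScore] tournament x ⟩
    n                                ≡⟨ n≡2m+1 ⟩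
    suc (m + m)                      ∎))
    where open ≡-Reasoning

  private
    killedBy : ∀ {a b t h} → a ≢ b → Arc T t h → OnEdge a b t h →
               (¬ StrongKing (reverseEdge T a b) v) ⇔ (t ≡ v ⊎ Arc T h v)
    killedBy a≢b t→h th∈ab = ArcReversal.¬strongKing⇔ tournament (reverseEdge-isTournament T tournament a≢b) regular
                               t→h (reverseEdge-isArcReversal tournament t→h th∈ab) v

    destroysOne : ∀ {t h} → Arc T t h → (t ≡ v ⊎ Arc T h v) ⇔ (Destroys T v t h ⊎ Destroys T v h t)
    destroysOne t→h = mk⇔ (λ kills → inj₁ (t→h , kills))
                          λ { (inj₁ (_ , kills)) → kills ; (inj₂ (h→t , _)) → contradiction h→t (asymmetric tournament t→h) }

    swap⇔ : ∀ {A B : Set} → (A ⊎ B) ⇔ (B ⊎ A)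
    swap⇔ = mk⇔ swap swap

  ¬strongKing-reverseEdge⇔ : ∀ {a b} → a ≢ b →
                             (¬ StrongKing (reverseEdge T a b) v) ⇔ (Destroys T v a b ⊎ Destroys T v b a)
  ¬strongKing-reverseEdge⇔ {a} {b} a≢b with arc? T a b
  ... | yes a→b = destroysOne a→b ⇔-∘ killedBy a≢b a→b (inj₁ (refl , refl))
  ... | no  a↛b = (swap⇔ ⇔-∘ destroysOne b→a) ⇔-∘ killedBy a≢b b→a (inj₂ (refl , refl))
    where b→a = ¬arc⇒arc tournament a≢b a↛b

  destroys : Fin n → Fin n → Bool
  destroys t h = does (destroys? T v t h)

  private
    destroys-asym : ∀ a b → destroys a b ≡ true → destroys b a ≡ false
    destroys-asym a b d with T a b in a→b | d
    ... | true | _ rewrite arc⇒converse≡false tournament a→b = refl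

    count-destroying-into : ∀ h → count (λ t → destroys t h) ≡ 𝟙 (T h v) * m + 𝟙 (T v h)
    count-destroying-into h with T h v in h→v
    ... | true = begin
      count (λ t → T t h ∧ (does (t ≟ v) ∨ true))  ≡⟨ count-cong (λ t → trans (cong (T t h ∧_) (∨-zeroʳ _)) (∧-identityʳ _)) ⟩
      inScore T h                                  ≡⟨ inScore-regular h ⟩
      m                                            ≡⟨ +-identityʳ m ⟨
      m + 0                                        ≡⟨ +-identityʳ (m + 0) ⟨
      m + 0 + 0                                    ≡⟨ cong (λ b → m + 0 + 𝟙 b) (arc⇒converse≡false tournament h→v) ⟨
      m + 0 + 𝟙 (T v h)                            ∎
      where open ≡-Reasoning
    ... | false = trans (count-cong (λ t → cong (T t h ∧_) (∨-identityʳ _))) (count-at v (λ t → T t h))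

  count-destroying : ∑[ t < n ] count (destroys t) ≡ m * m + m
  count-destroying = begin
    ∑[ t < n ] count (destroys t)                            ≡⟨ ∑-comm (λ t h → 𝟙 (destroys t h)) ⟩
    ∑[ h < n ] count (λ t → destroys t h)                    ≡⟨ sum-cong-≗ count-destroying-into ⟩
    ∑[ h < n ] (𝟙 (T h v) * m + 𝟙 (T v h))                  ≡⟨ ∑-distrib-+ (λ h → 𝟙 (T h v) * m) _ ⟩
    ∑[ h < n ] (𝟙 (T h v) * m) + score T v                  ≡⟨ cong₂ _+_ (*-distribʳ-sum m (λ h → 𝟙 (T h v))) (sym (regular v)) ⟨
    inScore T v * m + m                                      ≡⟨ cong (λ k → k * m + m) (inScore-regular v) ⟩
    m * m + m                                                ∎
    where open ≡-Reasoning

  DestroyingEdge : Fin n × Fin n → Set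
  DestroyingEdge (a , b) = a < b × (Destroys T v a b ⊎ Destroys T v b a)

  destroyingEdge? : Decidable DestroyingEdge
  destroyingEdge? (a , b) = a <? b ×-dec (destroys? T v a b ⊎-dec destroys? T v b a)

  destroyingEdges : List (Fin n × Fin n)
  destroyingEdges = filter destroyingEdge? (cartesianProduct (allFin n) (allFin n))

  destroyingEdges-unique : Unique destroyingEdges
  destroyingEdges-unique = filter⁺ destroyingEdge? (cartesianProduct⁺ (allFin⁺ n) (allFin⁺ n))

  ∈-destroyingEdges⇔ : ∀ a b → ((a , b) ∈ destroyingEdges) ⇔ (a < b × ¬ StrongKing (reverseEdge T a b) v)
  ∈-destroyingEdges⇔ a b = mk⇔
    (λ ab∈ → let (a<b , destroyed) = proj₂ (∈-filter⁻ destroyingEdge? {xs = cartesianProduct (allFin n) (allFin n)} ab∈) in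
             a<b , Equivalence.from (¬strongKing-reverseEdge⇔ (Fin.<⇒≢ a<b)) destroyed)
    (λ (a<b , ¬king) → ∈-filter⁺ destroyingEdge? (∈-cartesianProduct⁺ (∈-allFin a) (∈-allFin b))
                         (a<b , Equivalence.to (¬strongKing-reverseEdge⇔ (Fin.<⇒≢ a<b)) ¬king))

  length-destroyingEdges : length destroyingEdges ≡ m * m + m
  length-destroyingEdges = begin
    length destroyingEdges                                          ≡⟨ length-filter-cartesianProduct destroyingEdge? id id ⟩
    ∑[ a < n ] count (λ b → does (a <? b) ∧ (destroys a b ∨ destroys b a)) ≡⟨ count-unorderedPairs destroys destroys-asym ⟩
    ∑[ a < n ] count (destroys a)                                    ≡⟨ count-destroying ⟩
    m * m + m                                                        ∎
    where open ≡-Reasoning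

-- The tournament U n

-- U n x y unfolds to arcℕ (toℕ x) (toℕ y).
arcℕ : ℕ → ℕ → Bool
arcℕ i j = ((i <ᵇ j) ∧ (((i + j) % 2) ≡ᵇ 1)) ∨ ((j <ᵇ i) ∧ (((i + j) % 2) ≡ᵇ 0))

oddᵇ : ℕ → Bool
oddᵇ x = x % 2 ≡ᵇ 1

evenᵇ≡not-oddᵇ : ∀ x → (x % 2 ≡ᵇ 0) ≡ not (oddᵇ x)
evenᵇ≡not-oddᵇ zero          = refl
evenᵇ≡not-oddᵇ (suc zero)    = refl
evenᵇ≡not-oddᵇ (suc (suc x)) = evenᵇ≡not-oddᵇ x

oddᵇ-suc : ∀ x → oddᵇ (suc x) ≡ not (oddᵇ x)
oddᵇ-suc zero          = refl
oddᵇ-suc (suc zero)    = refl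
oddᵇ-suc (suc (suc x)) = oddᵇ-suc x

oddᵇ-double : ∀ x → oddᵇ (x + x) ≡ false
oddᵇ-double zero    = refl
oddᵇ-double (suc x) = trans (cong (oddᵇ ∘ suc) (+-suc x x)) (oddᵇ-double x)

<ᵇ-true : ∀ {i j} → i ℕ.< j → (i <ᵇ j) ≡ true
<ᵇ-true {i} {j} = dec-true (i ℕ.<? j)

<ᵇ-false : ∀ {i j} → j ≤ i → (i <ᵇ j) ≡ false
<ᵇ-false {i} {j} j≤i = dec-false (i ℕ.<? j) (≤⇒≯ j≤i)

arcℕ-< : ∀ {i j} → i ℕ.< j → arcℕ i j ≡ oddᵇ (i + j)
arcℕ-< {i} {j} i<j rewrite <ᵇ-true i<j | <ᵇ-false (<⇒≤ i<j) = ∨-identityʳ _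

arcℕ-> : ∀ {i j} → j ℕ.< i → arcℕ i j ≡ not (oddᵇ (i + j))
arcℕ-> {i} {j} j<i rewrite <ᵇ-false (<⇒≤ j<i) | <ᵇ-true j<i = evenᵇ≡not-oddᵇ (i + j)

arcℕ-irrefl : ∀ i → arcℕ i i ≡ false
arcℕ-irrefl i rewrite <ᵇ-false (≤-refl {i}) = refl

U-isTournament : ∀ n → IsTournament (U n)
U-isTournament n = record
  { irreflexive = λ x → arcℕ-irrefl (toℕ x)
  ; opposite    = λ {x} {y} → opposite-ℕ (toℕ x) (toℕ y) ∘ (_∘ toℕ-injective)
  }
  where
  opposite-ℕ : ∀ i j → i ≢ j → arcℕ j i ≡ not (arcℕ i j)
  opposite-ℕ i j i≢j with ℕ.<-cmp i j
  ... | tri< i<j _ _ rewrite arcℕ-> i<j | arcℕ-< i<j | +-comm j i = refl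
  ... | tri≈ _ i≡j _ = contradiction i≡j i≢j
  ... | tri> _ _ j<i rewrite arcℕ-< j<i | arcℕ-> j<i | +-comm j i = sym (not-involutive _)

count-toℕ-snoc : ∀ {N} (p : ℕ → Bool) → count {suc N} (p ∘ toℕ) ≡ count {N} (p ∘ toℕ) + 𝟙 (p N)
count-toℕ-snoc {N} p = trans (sum-init-last {N} (𝟙 ∘ p ∘ toℕ))
  (cong₂ _+_ (sum-cong-≗ {N} (cong (𝟙 ∘ p) ∘ toℕ-inject₁)) (cong (𝟙 ∘ p) (toℕ-fromℕ N)))

count-toℕ-oddStep : ∀ m (p : ℕ → Bool) →
                    count {suc (suc m + suc m)} (p ∘ toℕ)
                      ≡ count {suc (m + m)} (p ∘ toℕ) + (𝟙 (p (suc (m + m))) + 𝟙 (p (suc (suc (m + m)))))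
count-toℕ-oddStep m p = begin
  count {suc (suc m + suc m)} (p ∘ toℕ)
    ≡⟨ cong (λ N → count {suc (suc N)} (p ∘ toℕ)) (+-suc m m) ⟩
  count {suc (suc (suc (m + m)))} (p ∘ toℕ)
    ≡⟨ count-toℕ-snoc p ⟩
  count {suc (suc (m + m))} (p ∘ toℕ) + 𝟙 (p (suc (suc (m + m))))
    ≡⟨ cong (_+ 𝟙 (p (suc (suc (m + m))))) (count-toℕ-snoc p) ⟩
  count {suc (m + m)} (p ∘ toℕ) + 𝟙 (p (suc (m + m))) + 𝟙 (p (suc (suc (m + m))))
    ≡⟨ +-assoc (count {suc (m + m)} (p ∘ toℕ)) _ _ ⟩
  count {suc (m + m)} (p ∘ toℕ) + (𝟙 (p (suc (m + m))) + 𝟙 (p (suc (suc (m + m))))) ∎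
  where open ≡-Reasoning

-- i + N and i + (N + 1) have opposite parities, so i beats exactly one of N and N + 1.
arcℕ-pair : ∀ {i N} → i ≢ suc N → 𝟙 (arcℕ i N) + 𝟙 (arcℕ i (suc N)) ≡ 1
arcℕ-pair {i} {N} i≢1+N with ℕ.<-cmp i N
... | tri< i<N _ _ rewrite arcℕ-< i<N | arcℕ-< (m<n⇒m<1+n i<N) | +-suc i N | oddᵇ-suc (i + N) = 𝟙-excluded (oddᵇ (i + N))
... | tri≈ _ refl _ rewrite arcℕ-irrefl i | arcℕ-< (n<1+n i) | +-suc i i | oddᵇ-suc (i + i) | oddᵇ-double i = refl
... | tri> _ _ N<i rewrite arcℕ-> N<i | arcℕ-> (≤∧≢⇒< N<i (i≢1+N ∘ sym)) | +-suc i N | oddᵇ-suc (i + N)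
                         | not-involutive (oddᵇ (i + N)) = trans (+-comm (𝟙 (not (oddᵇ (i + N)))) _) (𝟙-excluded (oddᵇ (i + N)))

arcℕ-pair-suc : ∀ N → 𝟙 (arcℕ (suc N) N) + 𝟙 (arcℕ (suc N) (suc N)) ≡ 0
arcℕ-pair-suc N rewrite arcℕ-> (n<1+n N) | arcℕ-irrefl (suc N) | oddᵇ-suc (N + N) | oddᵇ-double N = refl

-- Past the end of the range, i beats exactly the vertices of its own parity; score-within meets
-- this case for the two vertices added at each step.
score-beyond : ∀ m {i} → suc (m + m) ≤ i → count {suc (m + m)} (arcℕ i ∘ toℕ) ≡ m + 𝟙 (not (oddᵇ i))
score-beyond zero    {i} 1≤i rewrite arcℕ-> 1≤i | +-identityʳ i = +-identityʳ _
score-beyond (suc m) {i} 2m+3≤i = begin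
  count {suc (suc m + suc m)} (arcℕ i ∘ toℕ)
    ≡⟨ count-toℕ-oddStep m (arcℕ i) ⟩
  count {suc (m + m)} (arcℕ i ∘ toℕ) + (𝟙 (arcℕ i (suc (m + m))) + 𝟙 (arcℕ i (suc (suc (m + m)))))
    ≡⟨ cong₂ _+_ (score-beyond m (≤-trans (n≤1+n _) (<⇒≤ 2m+2<i))) (arcℕ-pair (<⇒≢ 2m+2<i ∘ sym)) ⟩
  m + 𝟙 (not (oddᵇ i)) + 1
    ≡⟨ +-comm _ 1 ⟩
  suc m + 𝟙 (not (oddᵇ i)) ∎
  where
  open ≡-Reasoning
  2m+2<i : suc (suc (m + m)) ℕ.< i
  2m+2<i = subst (_≤ i) (cong (λ k → suc (suc k)) (+-suc m m)) 2m+3≤i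

score-within : ∀ m {i} → i ℕ.< suc (m + m) → count {suc (m + m)} (arcℕ i ∘ toℕ) ≡ m
score-within zero    {zero}  _         = refl
score-within zero    {suc _} (s≤s ())
score-within (suc m) {i} i<2m+3 = begin
  count {suc (suc m + suc m)} (arcℕ i ∘ toℕ)
    ≡⟨ count-toℕ-oddStep m (arcℕ i) ⟩
  count {suc (m + m)} (arcℕ i ∘ toℕ) + (𝟙 (arcℕ i (suc (m + m))) + 𝟙 (arcℕ i (suc (suc (m + m)))))
    ≡⟨ lastPair (m<1+n⇒m<n∨m≡n (subst (i ℕ.<_) (cong (λ k → suc (suc k)) (+-suc m m)) i<2m+3)) ⟩
  suc m ∎
  where
  open ≡-Reasoning
  lastPair : i ℕ.< suc (suc (m + m)) ⊎ i ≡ suc (suc (m + m)) →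
             count {suc (m + m)} (arcℕ i ∘ toℕ) + (𝟙 (arcℕ i (suc (m + m))) + 𝟙 (arcℕ i (suc (suc (m + m))))) ≡ suc m
  lastPair (inj₂ refl)
    rewrite score-beyond m (n≤1+n (suc (m + m))) | arcℕ-pair-suc (suc (m + m)) | oddᵇ-double m =
    trans (+-identityʳ _) (+-comm m 1)
  lastPair (inj₁ i<2m+2) with m<1+n⇒m<n∨m≡n i<2m+2
  ... | inj₂ refl
    rewrite score-beyond m ≤-refl | arcℕ-pair {suc (m + m)} {suc (m + m)} (<⇒≢ (n<1+n _))
          | oddᵇ-suc (m + m) | oddᵇ-double m =
    trans (cong (_+ 1) (+-identityʳ m)) (+-comm m 1)
  ... | inj₁ i<2m+1
    rewrite score-within m i<2m+1 | arcℕ-pair {i} {suc (m + m)} (<⇒≢ (m<n⇒m<1+n i<2m+1)) =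
    +-comm m 1

U-regular : ∀ {n m} → n ≡ suc (m + m) → ∀ x → score (U n) x ≡ m
U-regular {m = m} refl x = score-within m (toℕ<n x)

odd⇒≡suc[half+half] : ∀ n → n % 2 ≡ 1 → n ≡ suc (n / 2 + n / 2)
odd⇒≡suc[half+half] n n-odd =
  trans (m≡m%n+[m/n]*n n 2) (cong₂ _+_ n-odd (trans (*-comm (n / 2) 2) (cong (n / 2 +_) (+-identityʳ _))))

[odd²∸1]/4 : ∀ m → (suc (m + m) * suc (m + m) ∸ 1) / 4 ≡ m * m + m
[odd²∸1]/4 m = trans (cong (_/ 4) square) (m*n/n≡m (m * m + m) 4)
  where
  open +-*-Solver
  -- The left-hand side is what suc k * suc k ∸ 1 computes to, so no truncated subtraction is left.
  square : (m + m) + (m + m) * suc (m + m) ≡ (m * m + m) * 4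
  square = solve 1 (λ m → (m :+ m) :+ (m :+ m) :* (con 1 :+ (m :+ m)) := (m :* m :+ m) :* con 4) refl m

lemma4p5 : (n : ℕ) → n % 2 ≡ 1 → (v : Fin n) →
    ∃[ D ] (Unique D
      × (∀ (a b : Fin n) → ((a , b) ∈ D) ⇔ (a < b × ¬ StrongKing (reverseEdge (U n) a b) v))
      × length D ≡ (n * n ∸ 1) / 4)
lemma4p5 n n-odd v = destroyingEdges , destroyingEdges-unique , ∈-destroyingEdges⇔ , (begin
  length destroyingEdges                  ≡⟨ length-destroyingEdges ⟩
  m * m + m                               ≡⟨ [odd²∸1]/4 m ⟨
  (suc (m + m) * suc (m + m) ∸ 1) / 4     ≡⟨ cong (λ k → (k * k ∸ 1) / 4) n≡2m+1 ⟨
  (n * n ∸ 1) / 4                         ∎)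
  where
  m : ℕ
  m = n / 2
  n≡2m+1 : n ≡ suc (m + m)
  n≡2m+1 = odd⇒≡suc[half+half] n n-odd
  open RegularTournament (U-isTournament n) n≡2m+1 (U-regular {m = m} n≡2m+1) v
  open ≡-Reasoning
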